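{- The map $\delta_i$, restricted to outer deterministic multirelations, and the map $\delta_o$, restricted to inner deterministic multirelations, are mutually inverse isomorphisms (functors) between the category of inner deterministic multirelations and the category of outer deterministic multirelations (both with Peleg composition and identities $1_X$). They preserve the quantaloid structure given by arbitrary unions $\bigcup$ on inner deterministic multirelations and arbitrary inner unions $\underset{i}{\Cup}$ on outer deterministic multirelations.
   Context: A relation $T : X \leftrightarrow Y$ is a subset of $X\times Y$; a multirelation $R : X \leftrightarrow \mathcal{P} Y$ a subset of $X \times \mathcal{P} Y$. $R$ is outer deterministic if it is the graph of a function $X \to \mathcal{P} Y$; inner deterministic if $B$ is a singleton whenever $(a,B) \in R$. $\alpha(R) = \{(a,b) \mid \exists B.\ (a,B)\in R \wedge b \in B\}$; $\Lambda(T) = \{(a, T(a)) \mid a \in X\}$ where $T(a) = \{b \mid (a,b) \in T\}$; $\eta(T) = \{(a,\{b\}) \mid (a,b) \in T\}$. Fusion $\delta_o = \Lambda \circ \alpha$ and fission $\delta_i = \eta\circ\alpha$. $1_X = \{(a,\{a\}) \mid a \in X\}$. Peleg composition: $R \ast S = \{(a,C) \mid \exists B.\ (a,B) \in R \wedge \exists f : Y \to \mathcal{P} Z.\ (\forall b \in B.\ (b,f(b)) \in S) \wedge C = \bigcup_{b \in B} f(b)\}$. Inner union of a family: $\underset{i\in I}{\Cup} R_i = \{(a,\bigcup_{i\in I} A_i) \mid \forall i \in I.\ (a,A_i) \in R_i\}$. A quantaloid is a category whose homsets are complete lattices with composition preserving arbitrary sups in both arguments. -}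

module Defs where

open import Data.Product using (Σ; Σ-syntax; _×_; _,_; proj₁; proj₂)
open import Data.Unit using (⊤; tt)
open import Relation.Binary.PropositionalEquality using (_≡_)

Subset : Set → Set₁
Subset Y = Y → Set

_≗ₛ_ : {Y : Set} → Subset Y → Subset Y → Set
A ≗ₛ B = ∀ y → (A y → B y) × (B y → A y)

infix 4 _≗ₛ_

｛_｝ : {Y : Set} → Y → Subset Y
｛ b ｝ = λ y → y ≡ b

Rel : Set → Set → Set₁
Rel X Y = X → Y → Set

record Family (Y : Set) : Set₁ where
  field
    Idx : Set
    mem : Idx → Subset Y
open Family public

-- Multirelations R : X ↔ P Y : for each a, the set {B | (a,B) ∈ R}.
MRel : Set → Set → Set₁
MRel X Y = X → Family Y

_∋⟨_,_⟩ : {X Y : Set} → MRel X Y → X → Subset Y → Set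
R ∋⟨ a , B ⟩ = Σ[ j ∈ Idx (R a) ] (mem (R a) j ≗ₛ B)

_≐_ : {X Y : Set} → MRel X Y → MRel X Y → Set
_≐_ {X} R S = (a : X) →
    ((j : Idx (R a)) → S ∋⟨ a , mem (R a) j ⟩)
  × ((k : Idx (S a)) → R ∋⟨ a , mem (S a) k ⟩)

infix 4 _≐_

OuterDet : {X Y : Set} → MRel X Y → Set₁
OuterDet {X} {Y} R = Σ[ f ∈ (X → Subset Y) ] ((a : X) (B : Subset Y) →
  ((R ∋⟨ a , B ⟩ → B ≗ₛ f a) × (B ≗ₛ f a → R ∋⟨ a , B ⟩)))

InnerDet : {X Y : Set} → MRel X Y → Set
InnerDet {X} {Y} R = (a : X) (j : Idx (R a)) → Σ[ b ∈ Y ] (mem (R a) j ≗ₛ ｛ b ｝)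

α : {X Y : Set} → MRel X Y → Rel X Y
α R a b = Σ[ j ∈ Idx (R a) ] mem (R a) j b

Λ : {X Y : Set} → Rel X Y → MRel X Y
Λ T a = record { Idx = ⊤ ; mem = λ _ → T a }

η : {X Y : Set} → Rel X Y → MRel X Y
η {Y = Y} T a = record { Idx = Σ[ b ∈ Y ] T a b ; mem = λ p → ｛ proj₁ p ｝ }

δo : {X Y : Set} → MRel X Y → MRel X Y
δo R = Λ (α R)

δi : {X Y : Set} → MRel X Y → MRel X Y
δi R = η (α R)

one : (X : Set) → MRel X X
one X a = record { Idx = ⊤ ; mem = λ _ → ｛ a ｝ }

-- Peleg composition: choose B ∈ R a, and for each b ∈ B some f(b) with
-- (b , f b) ∈ S (f(b) must not depend on the proof of b ∈ B, up to
-- extensional equality); result ⋃_{b ∈ B} f(b).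
_*_ : {X Y Z : Set} → MRel X Y → MRel Y Z → MRel X Z
_*_ {X} {Y} {Z} R S a = record
  { Idx = Σ[ j ∈ Idx (R a) ] Σ[ f ∈ ((b : Y) → mem (R a) j b → Idx (S b)) ]
            ((b : Y) (p q : mem (R a) j b) → mem (S b) (f b p) ≗ₛ mem (S b) (f b q))
  ; mem = λ { (j , f , _) z → Σ[ b ∈ Y ] Σ[ p ∈ mem (R a) j b ] mem (S b) (f b p) z }
  }

⋃ : {X Y I : Set} → (I → MRel X Y) → MRel X Y
⋃ {I = I} R a = record
  { Idx = Σ[ i ∈ I ] Idx (R i a)
  ; mem = λ { (i , j) → mem (R i a) j } }

⋓ : {X Y I : Set} → (I → MRel X Y) → MRel X Y
⋓ {I = I} R a = record
  { Idx = (i : I) → Idx (R i a)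
  ; mem = λ k y → Σ[ i ∈ I ] mem (R i a) (k i) y }

{-# OPTIONS --safe #-}
module Submission where

-- Everything is transported to ordinary relations through α. An outer
-- deterministic R is recovered from its relation as Λ (α R), an inner
-- deterministic one as η (α R), while α ∘ Λ and α ∘ η are the identity. Λ and
-- η turn relational composition into Peleg composition and unions of
-- relations into inner unions and unions respectively, and α turns Peleg
-- composition into relational composition as soon as the left factor is inner
-- deterministic or the right one outer deterministic.

open import Defs
open import Data.Product using (_×_; Σ-syntax; _,_; proj₁; proj₂)
open import Data.Unit using (tt)
open import Relation.Binary.PropositionalEquality using (_≡_; refl; sym; trans; subst)
open import Relation.Binary.Construct.Composition using (_;_)

≗ₛ-refl : {Y : Set} {A : Subset Y} → A ≗ₛ A
≗ₛ-refl y = (λ x → x) , (λ x → x)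

≗ₛ-sym : {Y : Set} {A B : Subset Y} → A ≗ₛ B → B ≗ₛ A
≗ₛ-sym e y = proj₂ (e y) , proj₁ (e y)

≗ₛ-trans : {Y : Set} {A B C : Subset Y} → A ≗ₛ B → B ≗ₛ C → A ≗ₛ C
≗ₛ-trans e f y = (λ x → proj₁ (f y) (proj₁ (e y) x)) , (λ x → proj₂ (e y) (proj₂ (f y) x))

≐-sym : {X Y : Set} {R S : MRel X Y} → R ≐ S → S ≐ R
≐-sym R≐S a = proj₂ (R≐S a) , proj₁ (R≐S a)

≐-trans : {X Y : Set} {R S T : MRel X Y} → R ≐ S → S ≐ T → R ≐ T
≐-trans {R = R} {S} {T} R≐S S≐T a = forth , back
  where
  forth : (j : Idx (R a)) → T ∋⟨ a , mem (R a) j ⟩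
  forth j with proj₁ (R≐S a) j
  ... | k , e with proj₁ (S≐T a) k
  ... | l , e′ = l , ≗ₛ-trans e′ e

  back : (l : Idx (T a)) → R ∋⟨ a , mem (T a) l ⟩
  back l with proj₂ (S≐T a) l
  ... | k , e with proj₂ (R≐S a) k
  ... | j , e′ = j , ≗ₛ-trans e′ e

_≗ᵣ_ : {X Y : Set} → Rel X Y → Rel X Y → Set
T ≗ᵣ U = ∀ a → T a ≗ₛ U a

infix 4 _≗ᵣ_

Δ : (X : Set) → Rel X X
Δ X a = ｛ a ｝

⋃ᵣ : {X Y I : Set} → (I → Rel X Y) → Rel X Y
⋃ᵣ {I = I} T a b = Σ[ i ∈ I ] T i a b

module _ {X Y : Set} {R : MRel X Y} (od : OuterDet R) where

  outerDet-idx : (a : X) → Idx (R a)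
  outerDet-idx a = proj₁ (proj₂ (proj₂ od a (proj₁ od a)) ≗ₛ-refl)

  outerDet-mem≗α : (a : X) (j : Idx (R a)) → mem (R a) j ≗ₛ α R a
  outerDet-mem≗α a j y = (λ m → j , m) , λ { (k , m) → proj₂ (≡f j y) (proj₁ (≡f k y) m) }
    where
    ≡f : (k : Idx (R a)) → mem (R a) k ≗ₛ proj₁ od a
    ≡f k = proj₁ (proj₂ od a (mem (R a) k)) (k , ≗ₛ-refl)

module _ {X Y : Set} {R : MRel X Y} (idet : InnerDet R) where

  innerDet-≡ : {a : X} {j : Idx (R a)} {b c : Y} → mem (R a) j b → mem (R a) j c → b ≡ c
  innerDet-≡ {a} {j} {b} {c} m n =
    trans (proj₁ (proj₂ (idet a j) b) m) (sym (proj₁ (proj₂ (idet a j) c) n))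

  innerDet-≗｛｝ : {a : X} {j : Idx (R a)} {b : Y} → mem (R a) j b → mem (R a) j ≗ₛ ｛ b ｝
  innerDet-≗｛｝ {a} {j} m y = (λ n → innerDet-≡ n m) , λ { refl → m }

Λ-outerDet : {X Y : Set} (T : Rel X Y) → OuterDet (Λ T)
Λ-outerDet T = T , λ a B → (λ { (tt , e) → ≗ₛ-sym e }) , (λ e → tt , ≗ₛ-sym e)

η-innerDet : {X Y : Set} (T : Rel X Y) → InnerDet (η T)
η-innerDet T a (b , _) = b , ≗ₛ-refl

α-Λ : {X Y : Set} (T : Rel X Y) → α (Λ T) ≗ᵣ T
α-Λ T a y = (λ { (tt , t) → t }) , (λ t → tt , t)

α-η : {X Y : Set} (T : Rel X Y) → α (η T) ≗ᵣ T
α-η T a y = (λ { ((b , t) , refl) → t }) , (λ t → (y , t) , refl)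

Λ-cong : {X Y : Set} {T U : Rel X Y} → T ≗ᵣ U → Λ T ≐ Λ U
Λ-cong T≗U a = (λ _ → tt , ≗ₛ-sym (T≗U a)) , (λ _ → tt , T≗U a)

η-cong : {X Y : Set} {T U : Rel X Y} → T ≗ᵣ U → η T ≐ η U
η-cong T≗U a =
    (λ { (b , t) → (b , proj₁ (T≗U a b) t) , ≗ₛ-refl })
  , (λ { (b , u) → (b , proj₂ (T≗U a b) u) , ≗ₛ-refl })

Λ-α-outerDet : {X Y : Set} {R : MRel X Y} → OuterDet R → Λ (α R) ≐ R
Λ-α-outerDet od a =
    (λ _ → outerDet-idx od a , outerDet-mem≗α od a (outerDet-idx od a))
  , (λ k → tt , ≗ₛ-sym (outerDet-mem≗α od a k))

η-α-innerDet : {X Y : Set} {R : MRel X Y} → InnerDet R → η (α R) ≐ R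
η-α-innerDet {R = R} idet a =
    (λ { (y , j , m) → j , innerDet-≗｛｝ idet m })
  , λ k → let (b , k≗b) = idet a k in (b , k , proj₂ (k≗b b) refl) , ≗ₛ-sym k≗b

α-one : (X : Set) → α (one X) ≗ᵣ Δ X
α-one X a y = (λ { (tt , e) → e }) , (λ e → tt , e)

η-Δ : (X : Set) → η (Δ X) ≐ one X
η-Δ X a = (λ { (b , refl) → tt , ≗ₛ-refl }) , (λ _ → (a , refl) , ≗ₛ-refl)

Λ-; : {X Y Z : Set} (T : Rel X Y) (U : Rel Y Z) → Λ T * Λ U ≐ Λ (T ; U)
Λ-; T U a = (λ _ → tt , reassoc) , (λ _ → (tt , (λ _ _ → tt) , λ _ _ _ → ≗ₛ-refl) , ≗ₛ-sym reassoc)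
  where
  reassoc : (T ; U) a ≗ₛ λ z → Σ[ b ∈ _ ] Σ[ t ∈ T a b ] U b z
  reassoc z = (λ { (b , t , u) → b , t , u }) , (λ { (b , t , u) → b , t , u })

η-; : {X Y Z : Set} (T : Rel X Y) (U : Rel Y Z) → η T * η U ≐ η (T ; U)
η-; T U a = forth , back
  where
  forth : (j : Idx ((η T * η U) a)) → η (T ; U) ∋⟨ a , mem ((η T * η U) a) j ⟩
  forth ((b , t) , f , _) =
      (proj₁ (f b refl) , b , t , proj₂ (f b refl))
    , λ z → (λ { refl → b , refl , refl }) , λ { (_ , refl , e) → e }

  back : (k : Idx (η (T ; U) a)) → (η T * η U) ∋⟨ a , mem (η (T ; U) a) k ⟩
  back (c , b , t , u) =
      ((b , t) , (λ { _ refl → c , u }) , λ { _ refl refl → ≗ₛ-refl })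
    , λ z → (λ { (_ , refl , e) → e }) , (λ e → b , refl , e)

α-*-⊆ : {X Y Z : Set} (R : MRel X Y) (S : MRel Y Z) (a : X) (c : Z) → α (R * S) a c → (α R ; α S) a c
α-*-⊆ R S a c ((j , f , _) , b , p , s) = b , (j , p) , (f b p , s)

mem-subst : {Y Z : Set} (S : MRel Y Z) {b b′ : Y} (e : b ≡ b′) (k : Idx (S b)) →
            mem (S b′) (subst (λ y → Idx (S y)) e k) ≗ₛ mem (S b) k
mem-subst S refl k = ≗ₛ-refl

α-*-innerDet : {X Y Z : Set} {R : MRel X Y} (S : MRel Y Z) → InnerDet R → α (R * S) ≗ᵣ α R ; α S
α-*-innerDet {R = R} S idet a c = α-*-⊆ R S a c , λ { (b , (j , p) , (k , s)) → lift j p k s }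
  where
  -- The chosen set is {b}, so f only has to transport k along b ≡ b′.
  lift : ∀ {b} (j : Idx (R a)) (p : mem (R a) j b) (k : Idx (S b)) → mem (S b) k c → α (R * S) a c
  lift {b} j p k s = (j , f , f-resp) , b , p , proj₂ (mem-subst S (innerDet-≡ idet p p) k c) s
    where
    f : (b′ : _) → mem (R a) j b′ → Idx (S b′)
    f b′ q = subst (λ y → Idx (S y)) (innerDet-≡ idet p q) k

    f-resp : (b′ : _) (q q′ : mem (R a) j b′) → mem (S b′) (f b′ q) ≗ₛ mem (S b′) (f b′ q′)
    f-resp b′ q q′ = ≗ₛ-trans (mem-subst S (innerDet-≡ idet p q) k)
                              (≗ₛ-sym (mem-subst S (innerDet-≡ idet p q′) k))

α-*-outerDet : {X Y Z : Set} (R : MRel X Y) {S : MRel Y Z} → OuterDet S → α (R * S) ≗ᵣ α R ; α S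
α-*-outerDet R {S} od a c = α-*-⊆ R S a c , λ { (b , (j , p) , s) → lift j p s }
  where
  lift : ∀ {b} (j : Idx (R a)) (p : mem (R a) j b) → α S b c → α (R * S) a c
  lift {b} j p s =
      (j , (λ b′ _ → outerDet-idx od b′) , λ _ _ _ → ≗ₛ-refl)
    , b , p , proj₂ (outerDet-mem≗α od b (outerDet-idx od b) c) s

α-⋃ : {X Y I : Set} (R : I → MRel X Y) → α (⋃ R) ≗ᵣ ⋃ᵣ (λ i → α (R i))
α-⋃ R a y = (λ { ((i , j) , m) → i , j , m }) , (λ { (i , j , m) → (i , j) , m })

α-⋓ : {X Y I : Set} {R : I → MRel X Y} → ((i : I) → OuterDet (R i)) → α (⋓ R) ≗ᵣ ⋃ᵣ (λ i → α (R i))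
α-⋓ {R = R} od a y =
    (λ { (k , i , m) → i , k i , m })
  , λ { (i , m) → (λ i′ → outerDet-idx (od i′) a)
                , i , proj₂ (outerDet-mem≗α (od i) a (outerDet-idx (od i) a) y) m }

⋓-Λ : {X Y I : Set} (T : I → Rel X Y) → ⋓ (λ i → Λ (T i)) ≐ Λ (⋃ᵣ T)
⋓-Λ T a = (λ _ → tt , ≗ₛ-refl) , (λ _ → (λ _ → tt) , ≗ₛ-refl)

⋃-η : {X Y I : Set} (T : I → Rel X Y) → ⋃ (λ i → η (T i)) ≐ η (⋃ᵣ T)
⋃-η T a = (λ { (i , b , t) → (b , i , t) , ≗ₛ-refl }) , (λ { (b , i , t) → (i , b , t) , ≗ₛ-refl })

corollary3p10 : ((X Y : Set) (R : MRel X Y) → OuterDet R → InnerDet (δi R))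
    × ((X Y : Set) (R : MRel X Y) → InnerDet R → OuterDet (δo R))
    × ((X Y : Set) (R : MRel X Y) → OuterDet R → δo (δi R) ≐ R)
    × ((X Y : Set) (R : MRel X Y) → InnerDet R → δi (δo R) ≐ R)
    × ((X : Set) → δi (one X) ≐ one X)
    × ((X : Set) → δo (one X) ≐ one X)
    × ((X Y Z : Set) (R : MRel X Y) (S : MRel Y Z) → OuterDet R → OuterDet S →
    δi (R * S) ≐ δi R * δi S)
    × ((X Y Z : Set) (R : MRel X Y) (S : MRel Y Z) → InnerDet R → InnerDet S →
    δo (R * S) ≐ δo R * δo S)
    × ((X Y I : Set) (R : I → MRel X Y) → ((i : I) → InnerDet (R i)) →
    δo (⋃ R) ≐ ⋓ (λ i → δo (R i)))
    × ((X Y I : Set) (R : I → MRel X Y) → ((i : I) → OuterDet (R i)) →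
    δi (⋓ R) ≐ ⋃ (λ i → δi (R i)))
corollary3p10 =
    (λ _ _ R _ → η-innerDet (α R))
  , (λ _ _ R _ → Λ-outerDet (α R))
  , (λ _ _ R od → ≐-trans (Λ-cong (α-η (α R))) (Λ-α-outerDet od))
  , (λ _ _ R idet → ≐-trans (η-cong (α-Λ (α R))) (η-α-innerDet idet))
  , (λ X → ≐-trans (η-cong (α-one X)) (η-Δ X))
  , (λ X → Λ-cong (α-one X))
  , (λ _ _ _ R S _ odS → ≐-trans (η-cong (α-*-outerDet R odS)) (≐-sym (η-; (α R) (α S))))
  , (λ _ _ _ R S idR _ → ≐-trans (Λ-cong (α-*-innerDet S idR)) (≐-sym (Λ-; (α R) (α S))))
  , (λ _ _ _ R _ → ≐-trans (Λ-cong (α-⋃ R)) (≐-sym (⋓-Λ (λ i → α (R i)))))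
  , (λ _ _ _ R od → ≐-trans (η-cong (α-⋓ od)) (≐-sym (⋃-η (λ i → α (R i)))))
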